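{- Let $s$ be a positive integer, fix $i\in\{1,2,3\}$, and let $\mathcal{Z}_i=\mathcal{Z}_i(U_i,V_i)$ be the bipartite graph defined below. Let $U\subset U_i$ and $V\subset V_i$ with $|U|+|V|\le s-1$. If $|U|-|U\cap\{u_{s+1}\}|\le |V|-|V\cap\{v_{s+1}\}|$, then there exists $v\in (V_i\setminus V)\setminus\{v_{s+1}\}$ such that $e(\mathcal{Z}_i[U,V\cup\{v\}])\equiv |U|-|U\cap\{u_{s+1}\}|\pmod 2$. If $|U|-|U\cap\{u_{s+1}\}|>|V|-|V\cap\{v_{s+1}\}|$, then there exists $v\in(V_i\setminus V)\setminus\{v_{s+1}\}$ such that $e(\mathcal{Z}_i[U,V\cup\{v\}])\equiv |V|-|V\cap\{v_{s+1}\}|\pmod 2$. Furthermore, in either case, the vertex $v$ can be chosen so that in addition $N(V\cup\{v\})\not\subset U$.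
   Context: $\mathcal{Z}_1(U_1,V_1)$ is the bipartite graph with parts $U_1=\{u_1,\dots,u_s\}$, $V_1=\{v_1,\dots,v_s\}$ and edge set $\{u_jv_j:1\le j\le s\}$. $\mathcal{Z}_2(U_2,V_2)$ has parts $U_2=\{u_1,\dots,u_s,u_{s+1}\}$, $V_2=\{v_1,\dots,v_s\}$ and edge set $\{u_jv_j:1\le j\le s\}$. $\mathcal{Z}_3(U_3,V_3)$ has parts $U_3=\{u_1,\dots,u_s\}$, $V_3=\{v_1,\dots,v_s,v_{s+1}\}$ and edge set $\{u_jv_j:1\le j\le s\}$. (When $u_{s+1}$ or $v_{s+1}$ is not a vertex of the graph, intersections with $\{u_{s+1}\}$ or $\{v_{s+1}\}$ are empty.) For $U\subset U_i$, $V\subset V_i$, $e(\mathcal{Z}_i[U,V])$ is the number of edges of $\mathcal{Z}_i$ with one endpoint in $U$ and the other in $V$. For a vertex set $W$, $N(W)$ is the set of vertices adjacent to some vertex of $W$. -}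

module Defs where

open import Data.Bool using (Bool; true; false; _∧_; _∨_; if_then_else_)
open import Data.Nat using (ℕ; zero; suc; _+_; _<ᵇ_; _≡ᵇ_)
open import Data.Fin using (Fin; toℕ; fromℕ)
open import Data.Fin.Subset using (Subset; _∈_; _∉_)
open import Data.Vec using (tabulate; lookup)
open import Data.Product using (Σ; _×_)
open import Relation.Binary.PropositionalEquality using (_≡_)

-- Vertices on each side of Z_i (for a given s) are indexed by Fin (suc s):
-- index j with toℕ j < s stands for u_{j+1} (resp. v_{j+1});
-- index fromℕ s stands for u_{s+1} (resp. v_{s+1}).
-- The graph index i ∈ {1,2,3} is encoded as Fin 3: 0 ↦ Z_1, 1 ↦ Z_2, 2 ↦ Z_3.

extraU : Fin 3 → Bool
extraU Fin.zero = false
extraU (Fin.suc Fin.zero) = true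
extraU (Fin.suc (Fin.suc _)) = false

extraV : Fin 3 → Bool
extraV Fin.zero = false
extraV (Fin.suc Fin.zero) = false
extraV (Fin.suc (Fin.suc _)) = true

isLast : {s : ℕ} → Fin (suc s) → Bool
isLast {s} j = toℕ j ≡ᵇ s

Upart : Fin 3 → (s : ℕ) → Subset (suc s)
Upart i s = tabulate (λ j → (toℕ j <ᵇ s) ∨ (isLast j ∧ extraU i))

Vpart : Fin 3 → (s : ℕ) → Subset (suc s)
Vpart i s = tabulate (λ j → (toℕ j <ᵇ s) ∨ (isLast j ∧ extraV i))

edgeB : {s : ℕ} → Fin (suc s) → Fin (suc s) → Bool
edgeB {s} j k = (toℕ j ≡ᵇ toℕ k) ∧ (toℕ j <ᵇ s)

Edge : {s : ℕ} → Fin (suc s) → Fin (suc s) → Set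
Edge j k = edgeB j k ≡ true

sumFin : (n : ℕ) → (Fin n → ℕ) → ℕ
sumFin zero f = 0
sumFin (suc n) f = f Fin.zero + sumFin n (λ j → f (Fin.suc j))

eZ : {s : ℕ} → Subset (suc s) → Subset (suc s) → ℕ
eZ {s} U V = sumFin (suc s) (λ j → sumFin (suc s) (λ k →
  if lookup U j ∧ lookup V k ∧ edgeB j k then 1 else 0))

InN : (i : Fin 3) (s : ℕ) → Subset (suc s) → Fin (suc s) → Set
InN i s W u = (u ∈ Upart i s) × Σ (Fin (suc s)) (λ w → (w ∈ W) × Edge u w)

NnotSubset : (i : Fin 3) (s : ℕ) → Subset (suc s) → Subset (suc s) → Set
NnotSubset i s W U = Σ (Fin (suc s)) (λ u → InN i s W u × (u ∉ U))

-- Deleting the isolated vertices u_{s+1}, v_{s+1} leaves the perfect matching u_j v_j on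
-- Fin s. Identifying u_j with v_j there, e(U, V) is ∣ U ∩ V ∣, N(W) is W, and
-- ∣ U ∣ - ∣ U ∩ {u_{s+1}} ∣ is ∣ U ∣; in both cases the target parity is that of
-- t = ∣ U ∣ ⊓ ∣ V ∣ ≥ ∣ U ∩ V ∣. If ∣ U ∩ V ∣ ≡ t (mod 2), add a vertex outside U ∪ V (there
-- is one since ∣ U ∣ + ∣ V ∣ < s); it is itself a neighbour outside U. Otherwise
-- ∣ U ∩ V ∣ < t, so there are v ∈ U - V, whose addition raises e(U, V) by one, and
-- w ∈ V - U, a neighbour outside U.
module Submission where

open import Defs
open import Data.Nat using (ℕ; suc; _+_; _∸_; _≤_; _>_; _%_)
open import Data.Fin using (Fin; fromℕ)
open import Data.Fin.Subset using (Subset; _∈_; _∉_; _⊆_; _∩_; _∪_; ⁅_⁆; ∣_∣)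
open import Data.Product using (Σ; _×_)
open import Relation.Binary.PropositionalEquality using (_≡_; _≢_)

open import Data.Bool using (Bool; true; false; T; _∧_; _∨_; if_then_else_)
open import Data.Bool.Properties using (∧-zeroʳ; ∧-identityʳ; ∨-identityʳ)
open import Data.Fin using (zero; suc; toℕ; inject₁)
open import Data.Fin.Properties using (suc-injective; toℕ-injective; fromℕ≢inject₁)
open import Data.Fin.Subset using (⊥; ∁; Nonempty)
open import Data.Fin.Subset.Properties
  using (nonempty?; Empty-unique; ∣⊥∣≡0; ∣p∣≤∣x∷p∣; ∣∁p∣≡n∸∣p∣; ∣p∩q∣≤∣p∣⊓∣q∣;
         x∈⁅x⁆; x∈p∪q⁺; x∈p∩q⁻; x∈∁p⇒x∉p; drop-there; drop-not-there;
         ∩-comm; ∩-zeroʳ; ∪-identityʳ)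
open import Data.Nat using (zero; _<_; _⊓_; _<ᵇ_; _≡ᵇ_; _≟_; z≤n; s≤s; z<s)
open import Data.Nat.Properties
  using (+-identityʳ; +-assoc; +-suc; +-mono-≤; +-monoʳ-≤; n≤1+n; ≤-trans; ≤-<-trans; <-≤-trans;
         <⇒≤; <⇒≢; ≤∧≢⇒<; m+n∸m≡n; m<n⇒0<n∸m; ∸-monoʳ-<; m⊓n≤m; m⊓n≤n; m≤n⇒m⊓n≡m; m≥n⇒m⊓n≡n;
         ≡ᵇ⇒≡; ≡⇒≡ᵇ)
open import Data.Nat.DivMod using (%-distribˡ-+; m%n<n)
open import Data.Product using (_,_; ∃)
open import Data.Sum using (inj₁; inj₂)
open import Data.Vec using (Vec; []; _∷_; here; there; lookup; tabulate; zipWith; _∷ʳ_; initLast)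
open import Data.Vec.Properties using (lookup⇒[]=; lookup∘tabulate; lookup-zipWith)
open import Function using (_∘_)
open import Relation.Binary.PropositionalEquality
  using (refl; sym; trans; cong; cong₂; subst; ≢-sym; module ≡-Reasoning)
open import Relation.Nullary using (yes; no; contradiction)

open ≡-Reasoning

indicator : Bool → ℕ
indicator b = if b then 1 else 0

sumFin-cong : ∀ n {f g : Fin n → ℕ} → (∀ j → f j ≡ g j) → sumFin n f ≡ sumFin n g
sumFin-cong zero    f≗g = refl
sumFin-cong (suc n) f≗g = cong₂ _+_ (f≗g zero) (sumFin-cong n (f≗g ∘ suc))

sumFin-zero : ∀ n (f : Fin n → ℕ) → (∀ j → f j ≡ 0) → sumFin n f ≡ 0
sumFin-zero zero    f f≡0 = refl
sumFin-zero (suc n) f f≡0 = cong₂ _+_ (f≡0 zero) (sumFin-zero n (f ∘ suc) (f≡0 ∘ suc))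

sumFin-single : ∀ n (f : Fin n → ℕ) j → (∀ k → k ≢ j → f k ≡ 0) → sumFin n f ≡ f j
sumFin-single (suc n) f zero    f≡0 = begin
  f zero + sumFin n (f ∘ suc) ≡⟨ cong (f zero +_) (sumFin-zero n _ (λ k → f≡0 (suc k) (λ ()))) ⟩
  f zero + 0                  ≡⟨ +-identityʳ _ ⟩
  f zero                      ∎
sumFin-single (suc n) f (suc j) f≡0 =
  cong₂ _+_ (f≡0 zero (λ ()))
            (sumFin-single n (f ∘ suc) j (λ k k≢j → f≡0 (suc k) (k≢j ∘ suc-injective)))

sumFin-inject₁-fromℕ : ∀ n (f : Fin (suc n) → ℕ) → sumFin (suc n) f ≡ sumFin n (f ∘ inject₁) + f (fromℕ n)
sumFin-inject₁-fromℕ zero    f = +-identityʳ (f zero)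
sumFin-inject₁-fromℕ (suc n) f =
  trans (cong (f zero +_) (sumFin-inject₁-fromℕ n (f ∘ suc))) (sym (+-assoc (f zero) _ _))

sumFin-diagonal : ∀ n (g : Fin n → Fin n → Bool) → (∀ j k → k ≢ j → g j k ≡ false) →
  sumFin n (λ j → sumFin n (λ k → indicator (g j k))) ≡ sumFin n (λ j → indicator (g j j))
sumFin-diagonal n g off =
  sumFin-cong n (λ j → sumFin-single n _ j (λ k k≢j → cong indicator (off j k k≢j)))

∣p∣≡sumFin : ∀ {n} (p : Subset n) → ∣ p ∣ ≡ sumFin n (indicator ∘ lookup p)
∣p∣≡sumFin []          = refl
∣p∣≡sumFin (true ∷ p)  = cong suc (∣p∣≡sumFin p)
∣p∣≡sumFin (false ∷ p) = ∣p∣≡sumFin p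

∣p∣≡∣p∩q∣+∣p∩∁q∣ : ∀ {n} (p q : Subset n) → ∣ p ∣ ≡ ∣ p ∩ q ∣ + ∣ p ∩ ∁ q ∣
∣p∣≡∣p∩q∣+∣p∩∁q∣ []          []          = refl
∣p∣≡∣p∩q∣+∣p∩∁q∣ (true  ∷ p) (true  ∷ q) = cong suc (∣p∣≡∣p∩q∣+∣p∩∁q∣ p q)
∣p∣≡∣p∩q∣+∣p∩∁q∣ (true  ∷ p) (false ∷ q) =
  trans (cong suc (∣p∣≡∣p∩q∣+∣p∩∁q∣ p q)) (sym (+-suc ∣ p ∩ q ∣ ∣ p ∩ ∁ q ∣))
∣p∣≡∣p∩q∣+∣p∩∁q∣ (false ∷ p) (_     ∷ q) = ∣p∣≡∣p∩q∣+∣p∩∁q∣ p q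

∣p∪q∣≤∣p∣+∣q∣ : ∀ {n} (p q : Subset n) → ∣ p ∪ q ∣ ≤ ∣ p ∣ + ∣ q ∣
∣p∪q∣≤∣p∣+∣q∣ []          []          = z≤n
∣p∪q∣≤∣p∣+∣q∣ (true  ∷ p) (true  ∷ q) =
  s≤s (≤-trans (∣p∪q∣≤∣p∣+∣q∣ p q) (+-monoʳ-≤ ∣ p ∣ (n≤1+n ∣ q ∣)))
∣p∪q∣≤∣p∣+∣q∣ (true  ∷ p) (false ∷ q) = s≤s (∣p∪q∣≤∣p∣+∣q∣ p q)
∣p∪q∣≤∣p∣+∣q∣ (false ∷ p) (true  ∷ q) =
  subst (suc ∣ p ∪ q ∣ ≤_) (sym (+-suc ∣ p ∣ ∣ q ∣)) (s≤s (∣p∪q∣≤∣p∣+∣q∣ p q))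
∣p∪q∣≤∣p∣+∣q∣ (false ∷ p) (false ∷ q) = ∣p∪q∣≤∣p∣+∣q∣ p q

∣p∣>0⇒Nonempty : ∀ {n} (p : Subset n) → 0 < ∣ p ∣ → Nonempty p
∣p∣>0⇒Nonempty {n} p 0<∣p∣ with nonempty? p
... | yes p≢∅ = p≢∅
... | no  p≡∅ = contradiction (trans (cong ∣_∣ (Empty-unique p≡∅)) (∣⊥∣≡0 n)) (≢-sym (<⇒≢ 0<∣p∣))

∣p∩q∣<∣p∣⇒∃p─q : ∀ {n} (p q : Subset n) → ∣ p ∩ q ∣ < ∣ p ∣ → ∃ λ x → x ∈ p × x ∉ q
∣p∩q∣<∣p∣⇒∃p─q p q ∣p∩q∣<∣p∣ =
  let x , x∈p∩∁q = ∣p∣>0⇒Nonempty (p ∩ ∁ q) 0<∣p∩∁q∣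
      x∈p , x∈∁q = x∈p∩q⁻ p (∁ q) x∈p∩∁q
  in  x , x∈p , x∈∁p⇒x∉p x∈∁q
  where
  0<∣p∩∁q∣ : 0 < ∣ p ∩ ∁ q ∣
  0<∣p∩∁q∣ = subst (0 <_) ∣p∣∸∣p∩q∣≡∣p∩∁q∣ (m<n⇒0<n∸m ∣p∩q∣<∣p∣)
    where
    ∣p∣∸∣p∩q∣≡∣p∩∁q∣ : ∣ p ∣ ∸ ∣ p ∩ q ∣ ≡ ∣ p ∩ ∁ q ∣
    ∣p∣∸∣p∩q∣≡∣p∩∁q∣ = trans (cong (_∸ ∣ p ∩ q ∣) (∣p∣≡∣p∩q∣+∣p∩∁q∣ p q)) (m+n∸m≡n ∣ p ∩ q ∣ ∣ p ∩ ∁ q ∣)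

∣p∣+∣q∣<n⇒∃∁[p∪q] : ∀ {n} (p q : Subset n) → ∣ p ∣ + ∣ q ∣ < n → ∃ λ x → x ∉ p × x ∉ q
∣p∣+∣q∣<n⇒∃∁[p∪q] p q ∣p∣+∣q∣<n =
  let x , x∈∁[p∪q] = ∣p∣>0⇒Nonempty (∁ (p ∪ q)) 0<∣∁[p∪q]∣
      x∉p∪q        = x∈∁p⇒x∉p x∈∁[p∪q]
  in  x , x∉p∪q ∘ x∈p∪q⁺ ∘ inj₁ , x∉p∪q ∘ x∈p∪q⁺ ∘ inj₂
  where
  0<∣∁[p∪q]∣ : 0 < ∣ ∁ (p ∪ q) ∣
  0<∣∁[p∪q]∣ = subst (0 <_) (sym (∣∁p∣≡n∸∣p∣ (p ∪ q)))
                     (m<n⇒0<n∸m (≤-<-trans (∣p∪q∣≤∣p∣+∣q∣ p q) ∣p∣+∣q∣<n))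

x∉p⇒∣p∩[q∪⁅x⁆]∣≡∣p∩q∣ : ∀ {n} {x : Fin n} (p q : Subset n) → x ∉ p → ∣ p ∩ (q ∪ ⁅ x ⁆) ∣ ≡ ∣ p ∩ q ∣
x∉p⇒∣p∩[q∪⁅x⁆]∣≡∣p∩q∣ {x = zero}  (true  ∷ p) (_     ∷ q) x∉p = contradiction here x∉p
x∉p⇒∣p∩[q∪⁅x⁆]∣≡∣p∩q∣ {x = zero}  (false ∷ p) (_     ∷ q) x∉p = cong (∣_∣ ∘ (p ∩_)) (∪-identityʳ q)
x∉p⇒∣p∩[q∪⁅x⁆]∣≡∣p∩q∣ {x = suc x} (true  ∷ p) (true  ∷ q) x∉p =
  cong suc (x∉p⇒∣p∩[q∪⁅x⁆]∣≡∣p∩q∣ p q (drop-not-there x∉p))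
x∉p⇒∣p∩[q∪⁅x⁆]∣≡∣p∩q∣ {x = suc x} (true  ∷ p) (false ∷ q) x∉p =
  x∉p⇒∣p∩[q∪⁅x⁆]∣≡∣p∩q∣ p q (drop-not-there x∉p)
x∉p⇒∣p∩[q∪⁅x⁆]∣≡∣p∩q∣ {x = suc x} (false ∷ p) (_     ∷ q) x∉p =
  x∉p⇒∣p∩[q∪⁅x⁆]∣≡∣p∩q∣ p q (drop-not-there x∉p)

x∈p∧x∉q⇒∣p∩[q∪⁅x⁆]∣≡1+∣p∩q∣ : ∀ {n} {x : Fin n} (p q : Subset n) → x ∈ p → x ∉ q →
  ∣ p ∩ (q ∪ ⁅ x ⁆) ∣ ≡ suc ∣ p ∩ q ∣
x∈p∧x∉q⇒∣p∩[q∪⁅x⁆]∣≡1+∣p∩q∣ {x = zero}  (true ∷ p) (true  ∷ q) x∈p x∉q = contradiction here x∉q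
x∈p∧x∉q⇒∣p∩[q∪⁅x⁆]∣≡1+∣p∩q∣ {x = zero}  (true ∷ p) (false ∷ q) x∈p x∉q =
  cong (suc ∘ ∣_∣ ∘ (p ∩_)) (∪-identityʳ q)
x∈p∧x∉q⇒∣p∩[q∪⁅x⁆]∣≡1+∣p∩q∣ {x = suc x} (true ∷ p) (true  ∷ q) x∈p x∉q =
  cong suc (x∈p∧x∉q⇒∣p∩[q∪⁅x⁆]∣≡1+∣p∩q∣ p q (drop-there x∈p) (drop-not-there x∉q))
x∈p∧x∉q⇒∣p∩[q∪⁅x⁆]∣≡1+∣p∩q∣ {x = suc x} (true ∷ p) (false ∷ q) x∈p x∉q =
  x∈p∧x∉q⇒∣p∩[q∪⁅x⁆]∣≡1+∣p∩q∣ p q (drop-there x∈p) (drop-not-there x∉q)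
x∈p∧x∉q⇒∣p∩[q∪⁅x⁆]∣≡1+∣p∩q∣ {x = suc x} (false ∷ p) (_     ∷ q) x∈p x∉q =
  x∈p∧x∉q⇒∣p∩[q∪⁅x⁆]∣≡1+∣p∩q∣ p q (drop-there x∈p) (drop-not-there x∉q)

[1+m]%2≡n%2 : ∀ m n → m % 2 ≢ n % 2 → suc m % 2 ≡ n % 2
[1+m]%2≡n%2 m n m≢n =
  trans (%-distribˡ-+ 1 m 2) (flip-bit (m % 2) (n % 2) (m%n<n m 2) (m%n<n n 2) m≢n)
  where
  flip-bit : ∀ a b → a < 2 → b < 2 → a ≢ b → suc a % 2 ≡ b
  flip-bit 0 0 _ _ a≢b = contradiction refl a≢b
  flip-bit 0 1 _ _ _   = refl
  flip-bit 1 0 _ _ _   = refl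
  flip-bit 1 1 _ _ a≢b = contradiction refl a≢b
  flip-bit (suc (suc a)) _ (s≤s (s≤s ())) _ _
  flip-bit _ (suc (suc b)) _ (s≤s (s≤s ())) _

MatchingExtension : ∀ {s} (U V : Subset s) (t : ℕ) → Set
MatchingExtension {s} U V t = Σ (Fin s) λ v → v ∉ V × ∣ U ∩ (V ∪ ⁅ v ⁆) ∣ % 2 ≡ t % 2 ×
  ∃ λ w → w ∈ V ∪ ⁅ v ⁆ × w ∉ U

matching-extension : ∀ {s} (U V : Subset s) → ∣ U ∣ + ∣ V ∣ < s → MatchingExtension U V (∣ U ∣ ⊓ ∣ V ∣)
matching-extension U V ∣U∣+∣V∣<s with ∣ U ∩ V ∣ % 2 ≟ (∣ U ∣ ⊓ ∣ V ∣) % 2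
... | yes same-parity =
  let v , v∉U , v∉V = ∣p∣+∣q∣<n⇒∃∁[p∪q] U V ∣U∣+∣V∣<s
  in  v , v∉V , trans (cong (_% 2) (x∉p⇒∣p∩[q∪⁅x⁆]∣≡∣p∩q∣ U V v∉U)) same-parity ,
      v , x∈p∪q⁺ (inj₂ (x∈⁅x⁆ v)) , v∉U
... | no other-parity =
  let v , v∈U , v∉V = ∣p∩q∣<∣p∣⇒∃p─q U V (<-≤-trans ∣U∩V∣<min (m⊓n≤m _ _))
      w , w∈V , w∉U = ∣p∩q∣<∣p∣⇒∃p─q V U ∣V∩U∣<∣V∣
  in  v , v∉V , trans (cong (_% 2) (x∈p∧x∉q⇒∣p∩[q∪⁅x⁆]∣≡1+∣p∩q∣ U V v∈U v∉V)) flipped-parity ,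
      w , x∈p∪q⁺ (inj₁ w∈V) , w∉U
  where
  ∣U∩V∣<min : ∣ U ∩ V ∣ < ∣ U ∣ ⊓ ∣ V ∣
  ∣U∩V∣<min = ≤∧≢⇒< (∣p∩q∣≤∣p∣⊓∣q∣ U V) (other-parity ∘ cong (_% 2))

  ∣V∩U∣<∣V∣ : ∣ V ∩ U ∣ < ∣ V ∣
  ∣V∩U∣<∣V∣ = subst (λ r → ∣ r ∣ < ∣ V ∣) (∩-comm U V) (<-≤-trans ∣U∩V∣<min (m⊓n≤n _ _))

  flipped-parity : suc ∣ U ∩ V ∣ % 2 ≡ (∣ U ∣ ⊓ ∣ V ∣) % 2
  flipped-parity = [1+m]%2≡n%2 ∣ U ∩ V ∣ (∣ U ∣ ⊓ ∣ V ∣) other-parity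

∈-∷ʳ⁺ : ∀ {n} {p : Subset n} {j} x → j ∈ p → inject₁ j ∈ p ∷ʳ x
∈-∷ʳ⁺ x here        = here
∈-∷ʳ⁺ x (there j∈p) = there (∈-∷ʳ⁺ x j∈p)

∈-∷ʳ⁻ : ∀ {n} (p : Subset n) {j} x → inject₁ j ∈ p ∷ʳ x → j ∈ p
∈-∷ʳ⁻ (_ ∷ p) {zero}  x here      = here
∈-∷ʳ⁻ (_ ∷ p) {suc j} x (there m) = there (∈-∷ʳ⁻ p x m)

lookup-∷ʳ-inject₁ : ∀ {n} {A : Set} (xs : Vec A n) x j → lookup (xs ∷ʳ x) (inject₁ j) ≡ lookup xs j
lookup-∷ʳ-inject₁ (y ∷ xs) x zero    = refl
lookup-∷ʳ-inject₁ (y ∷ xs) x (suc j) = lookup-∷ʳ-inject₁ xs x j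

zipWith-∷ʳ : ∀ {n} {A B C : Set} (f : A → B → C) (xs : Vec A n) ys x y →
  zipWith f (xs ∷ʳ x) (ys ∷ʳ y) ≡ zipWith f xs ys ∷ʳ f x y
zipWith-∷ʳ f []       []       x y = refl
zipWith-∷ʳ f (x′ ∷ xs) (y′ ∷ ys) x y = cong (f x′ y′ ∷_) (zipWith-∷ʳ f xs ys x y)

⊥≡⊥∷ʳoutside : ∀ n → ⊥ {suc n} ≡ ⊥ ∷ʳ false
⊥≡⊥∷ʳoutside zero    = refl
⊥≡⊥∷ʳoutside (suc n) = cong (false ∷_) (⊥≡⊥∷ʳoutside n)

⁅inject₁⁆≡⁅⁆∷ʳoutside : ∀ {n} (j : Fin n) → ⁅ inject₁ j ⁆ ≡ ⁅ j ⁆ ∷ʳ false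
⁅inject₁⁆≡⁅⁆∷ʳoutside {suc n} zero    = cong (true ∷_) (⊥≡⊥∷ʳoutside n)
⁅inject₁⁆≡⁅⁆∷ʳoutside {suc n} (suc j) = cong (false ∷_) (⁅inject₁⁆≡⁅⁆∷ʳoutside j)

⁅fromℕ⁆≡⊥∷ʳinside : ∀ n → ⁅ fromℕ n ⁆ ≡ ⊥ ∷ʳ true
⁅fromℕ⁆≡⊥∷ʳinside zero    = refl
⁅fromℕ⁆≡⊥∷ʳinside (suc n) = cong (false ∷_) (⁅fromℕ⁆≡⊥∷ʳinside n)

∣p∷ʳx∣≡∣x∷p∣ : ∀ {n} (p : Subset n) x → ∣ p ∷ʳ x ∣ ≡ ∣ x ∷ p ∣
∣p∷ʳx∣≡∣x∷p∣ []          x     = refl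
∣p∷ʳx∣≡∣x∷p∣ (true  ∷ p) true  = cong suc (∣p∷ʳx∣≡∣x∷p∣ p true)
∣p∷ʳx∣≡∣x∷p∣ (true  ∷ p) false = cong suc (∣p∷ʳx∣≡∣x∷p∣ p false)
∣p∷ʳx∣≡∣x∷p∣ (false ∷ p) x     = ∣p∷ʳx∣≡∣x∷p∣ p x

∣p∣≤∣p∷ʳx∣ : ∀ {n} (p : Subset n) x → ∣ p ∣ ≤ ∣ p ∷ʳ x ∣
∣p∣≤∣p∷ʳx∣ p x = subst (∣ p ∣ ≤_) (sym (∣p∷ʳx∣≡∣x∷p∣ p x)) (∣p∣≤∣x∷p∣ x p)

∣x∷p∣∸∣x∷⊥∣≡∣p∣ : ∀ {n} x (p : Subset n) → ∣ x ∷ p ∣ ∸ ∣ x ∷ ⊥ {n} ∣ ≡ ∣ p ∣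
∣x∷p∣∸∣x∷⊥∣≡∣p∣ {n} true  p = cong (∣ p ∣ ∸_) (∣⊥∣≡0 n)
∣x∷p∣∸∣x∷⊥∣≡∣p∣ {n} false p = cong (∣ p ∣ ∸_) (∣⊥∣≡0 n)

∣p∷ʳx∣∸∣p∷ʳx∩⁅fromℕ⁆∣≡∣p∣ : ∀ {n} (p : Subset n) x → ∣ p ∷ʳ x ∣ ∸ ∣ (p ∷ʳ x) ∩ ⁅ fromℕ n ⁆ ∣ ≡ ∣ p ∣
∣p∷ʳx∣∸∣p∷ʳx∩⁅fromℕ⁆∣≡∣p∣ {n} p x = begin
  ∣ p ∷ʳ x ∣ ∸ ∣ (p ∷ʳ x) ∩ ⁅ fromℕ n ⁆ ∣
    ≡⟨ cong (λ r → ∣ p ∷ʳ x ∣ ∸ ∣ (p ∷ʳ x) ∩ r ∣) (⁅fromℕ⁆≡⊥∷ʳinside n) ⟩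
  ∣ p ∷ʳ x ∣ ∸ ∣ (p ∷ʳ x) ∩ (⊥ {n} ∷ʳ true) ∣
    ≡⟨ cong (λ r → ∣ p ∷ʳ x ∣ ∸ ∣ r ∣) (zipWith-∷ʳ _∧_ p (⊥ {n}) x true) ⟩
  ∣ p ∷ʳ x ∣ ∸ ∣ (p ∩ ⊥) ∷ʳ (x ∧ true) ∣
    ≡⟨ cong₂ (λ r y → ∣ p ∷ʳ x ∣ ∸ ∣ r ∷ʳ y ∣) (∩-zeroʳ p) (∧-identityʳ x) ⟩
  ∣ p ∷ʳ x ∣ ∸ ∣ ⊥ {n} ∷ʳ x ∣
    ≡⟨ cong₂ _∸_ (∣p∷ʳx∣≡∣x∷p∣ p x) (∣p∷ʳx∣≡∣x∷p∣ (⊥ {n}) x) ⟩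
  ∣ x ∷ p ∣ ∸ ∣ x ∷ ⊥ {n} ∣
    ≡⟨ ∣x∷p∣∸∣x∷⊥∣≡∣p∣ x p ⟩
  ∣ p ∣ ∎

toℕ-inject₁<ᵇ : ∀ {s} (j : Fin s) → (toℕ (inject₁ j) <ᵇ s) ≡ true
toℕ-inject₁<ᵇ {suc s} zero    = refl
toℕ-inject₁<ᵇ {suc s} (suc j) = toℕ-inject₁<ᵇ j

toℕ-fromℕ<ᵇ : ∀ s → (toℕ (fromℕ s) <ᵇ s) ≡ false
toℕ-fromℕ<ᵇ zero    = refl
toℕ-fromℕ<ᵇ (suc s) = toℕ-fromℕ<ᵇ s

edgeB-diagonal : ∀ {s} (j : Fin (suc s)) → edgeB j j ≡ (toℕ j <ᵇ s)
edgeB-diagonal j with toℕ j ≡ᵇ toℕ j in eq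
... | true  = refl
... | false = contradiction (subst T eq (≡⇒≡ᵇ (toℕ j) (toℕ j) refl)) (λ ())

edgeB-off-diagonal : ∀ {s} (j k : Fin (suc s)) → k ≢ j → edgeB j k ≡ false
edgeB-off-diagonal j k k≢j with toℕ j ≡ᵇ toℕ k in eq
... | false = refl
... | true  = contradiction (toℕ-injective (≡ᵇ⇒≡ (toℕ j) (toℕ k) (subst T (sym eq) _))) (≢-sym k≢j)

edgeB-inject₁ : ∀ {s} (j : Fin s) → edgeB (inject₁ j) (inject₁ j) ≡ true
edgeB-inject₁ j = trans (edgeB-diagonal (inject₁ j)) (toℕ-inject₁<ᵇ j)

edgeB-fromℕ : ∀ s → edgeB (fromℕ s) (fromℕ s) ≡ false
edgeB-fromℕ s = trans (edgeB-diagonal (fromℕ s)) (toℕ-fromℕ<ᵇ s)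

∧-∧-false : ∀ a b {c} → c ≡ false → a ∧ b ∧ c ≡ false
∧-∧-false a b refl = trans (cong (a ∧_) (∧-zeroʳ b)) (∧-zeroʳ a)

eZ-∷ʳ : ∀ {s} (U W : Subset s) x y → eZ (U ∷ʳ x) (W ∷ʳ y) ≡ ∣ U ∩ W ∣
eZ-∷ʳ {s} U W x y = begin
  eZ (U ∷ʳ x) (W ∷ʳ y)                        ≡⟨ sumFin-diagonal (suc s) _ off-diagonal ⟩
  sumFin (suc s) (indicator ∘ diagonal)       ≡⟨ sumFin-inject₁-fromℕ s (indicator ∘ diagonal) ⟩
  sumFin s (indicator ∘ diagonal ∘ inject₁) + indicator (diagonal (fromℕ s))
    ≡⟨ cong₂ _+_ (sumFin-cong s (cong indicator ∘ matched)) (cong indicator unmatched) ⟩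
  sumFin s (indicator ∘ lookup (U ∩ W)) + 0   ≡⟨ +-identityʳ _ ⟩
  sumFin s (indicator ∘ lookup (U ∩ W))       ≡⟨ ∣p∣≡sumFin (U ∩ W) ⟨
  ∣ U ∩ W ∣                                   ∎
  where
  diagonal : Fin (suc s) → Bool
  diagonal j = lookup (U ∷ʳ x) j ∧ lookup (W ∷ʳ y) j ∧ edgeB j j

  off-diagonal : ∀ j k → k ≢ j → lookup (U ∷ʳ x) j ∧ lookup (W ∷ʳ y) k ∧ edgeB j k ≡ false
  off-diagonal j k k≢j =
    ∧-∧-false (lookup (U ∷ʳ x) j) (lookup (W ∷ʳ y) k) (edgeB-off-diagonal j k k≢j)

  matched : ∀ j → diagonal (inject₁ j) ≡ lookup (U ∩ W) j
  matched j = begin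
    diagonal (inject₁ j)
      ≡⟨ cong₂ (λ a b → a ∧ b ∧ edgeB (inject₁ j) (inject₁ j)) (lookup-∷ʳ-inject₁ U x j) (lookup-∷ʳ-inject₁ W y j) ⟩
    lookup U j ∧ lookup W j ∧ edgeB (inject₁ j) (inject₁ j)
      ≡⟨ cong (λ e → lookup U j ∧ lookup W j ∧ e) (edgeB-inject₁ j) ⟩
    lookup U j ∧ lookup W j ∧ true
      ≡⟨ cong (lookup U j ∧_) (∧-identityʳ _) ⟩
    lookup U j ∧ lookup W j
      ≡⟨ lookup-zipWith _∧_ j U W ⟨
    lookup (U ∩ W) j ∎

  unmatched : diagonal (fromℕ s) ≡ false
  unmatched = ∧-∧-false (lookup (U ∷ʳ x) (fromℕ s)) (lookup (W ∷ʳ y) (fromℕ s)) (edgeB-fromℕ s)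

inject₁∈tabulate : ∀ {s} (c : Fin (suc s) → Bool) (j : Fin s) →
  inject₁ j ∈ tabulate (λ k → (toℕ k <ᵇ s) ∨ c k)
inject₁∈tabulate {s} c j = lookup⇒[]= (inject₁ j) _
  (trans (lookup∘tabulate (λ k → (toℕ k <ᵇ s) ∨ c k) (inject₁ j)) (cong (_∨ c (inject₁ j)) (toℕ-inject₁<ᵇ j)))

ExtendingVertex : (i : Fin 3) (s : ℕ) (U V : Subset (suc s)) (t : ℕ) → Set
ExtendingVertex i s U V t = Σ (Fin (suc s)) (λ v → (v ∈ Vpart i s) × (v ∉ V) × (v ≢ fromℕ s) ×
  (eZ U (V ∪ ⁅ v ⁆) % 2 ≡ t % 2) × NnotSubset i s (V ∪ ⁅ v ⁆) U)

extending-vertex : ∀ {s} i (U V : Subset s) x y t →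
  MatchingExtension U V t → ExtendingVertex i s (U ∷ʳ x) (V ∷ʳ y) t
extending-vertex {s} i U V x y t (v , v∉V , parity , w , w∈V∪⁅v⁆ , w∉U) =
  inject₁ v , inject₁∈tabulate (λ k → isLast k ∧ extraV i) v , v∉V ∘ ∈-∷ʳ⁻ V y , ≢-sym fromℕ≢inject₁ ,
  trans (cong (λ r → eZ (U ∷ʳ x) r % 2) V∪⁅v⁆) (trans (cong (_% 2) (eZ-∷ʳ U (V ∪ ⁅ v ⁆) x y)) parity) ,
  inject₁ w , (inject₁∈tabulate (λ k → isLast k ∧ extraU i) w , inject₁ w ,
               subst (inject₁ w ∈_) (sym V∪⁅v⁆) (∈-∷ʳ⁺ y w∈V∪⁅v⁆) ,
               edgeB-inject₁ w) ,
  w∉U ∘ ∈-∷ʳ⁻ U x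
  where
  V∪⁅v⁆ : (V ∷ʳ y) ∪ ⁅ inject₁ v ⁆ ≡ (V ∪ ⁅ v ⁆) ∷ʳ y
  V∪⁅v⁆ = begin
    (V ∷ʳ y) ∪ ⁅ inject₁ v ⁆       ≡⟨ cong ((V ∷ʳ y) ∪_) (⁅inject₁⁆≡⁅⁆∷ʳoutside v) ⟩
    (V ∷ʳ y) ∪ (⁅ v ⁆ ∷ʳ false)    ≡⟨ zipWith-∷ʳ _∨_ V ⁅ v ⁆ y false ⟩
    (V ∪ ⁅ v ⁆) ∷ʳ (y ∨ false)     ≡⟨ cong ((V ∪ ⁅ v ⁆) ∷ʳ_) (∨-identityʳ y) ⟩
    (V ∪ ⁅ v ⁆) ∷ʳ y               ∎

lemma2p3 : (s : ℕ) → 1 ≤ s → (i : Fin 3) → (U V : Subset (suc s)) →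
    U ⊆ Upart i s → V ⊆ Vpart i s → ∣ U ∣ + ∣ V ∣ ≤ s ∸ 1 →
    ((∣ U ∣ ∸ ∣ U ∩ ⁅ fromℕ s ⁆ ∣ ≤ ∣ V ∣ ∸ ∣ V ∩ ⁅ fromℕ s ⁆ ∣ →
      Σ (Fin (suc s)) (λ v → (v ∈ Vpart i s) × (v ∉ V) × (v ≢ fromℕ s) ×
        (eZ U (V ∪ ⁅ v ⁆) % 2 ≡ (∣ U ∣ ∸ ∣ U ∩ ⁅ fromℕ s ⁆ ∣) % 2) ×
        NnotSubset i s (V ∪ ⁅ v ⁆) U))
    × (∣ U ∣ ∸ ∣ U ∩ ⁅ fromℕ s ⁆ ∣ > ∣ V ∣ ∸ ∣ V ∩ ⁅ fromℕ s ⁆ ∣ →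
      Σ (Fin (suc s)) (λ v → (v ∈ Vpart i s) × (v ∉ V) × (v ≢ fromℕ s) ×
        (eZ U (V ∪ ⁅ v ⁆) % 2 ≡ (∣ V ∣ ∸ ∣ V ∩ ⁅ fromℕ s ⁆ ∣) % 2) ×
        NnotSubset i s (V ∪ ⁅ v ⁆) U)))
lemma2p3 s 1≤s i U V _ _ ∣U∣+∣V∣≤s∸1 with initLast U | initLast V
... | U′ , x , refl | V′ , y , refl
  rewrite ∣p∷ʳx∣∸∣p∷ʳx∩⁅fromℕ⁆∣≡∣p∣ U′ x | ∣p∷ʳx∣∸∣p∷ʳx∩⁅fromℕ⁆∣≡∣p∣ V′ y =
  (λ a≤b → subst (ExtendingVertex i s _ _) (m≤n⇒m⊓n≡m a≤b) extension) ,
  (λ b<a → subst (ExtendingVertex i s _ _) (m≥n⇒m⊓n≡n (<⇒≤ b<a)) extension)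
  where
  ∣U′∣+∣V′∣<s : ∣ U′ ∣ + ∣ V′ ∣ < s
  ∣U′∣+∣V′∣<s = ≤-<-trans (+-mono-≤ (∣p∣≤∣p∷ʳx∣ U′ x) (∣p∣≤∣p∷ʳx∣ V′ y))
                          (≤-<-trans ∣U∣+∣V∣≤s∸1 (∸-monoʳ-< z<s 1≤s))
  extension : ExtendingVertex i s (U′ ∷ʳ x) (V′ ∷ʳ y) (∣ U′ ∣ ⊓ ∣ V′ ∣)
  extension = extending-vertex i U′ V′ x y (∣ U′ ∣ ⊓ ∣ V′ ∣) (matching-extension U′ V′ ∣U′∣+∣V′∣<s)
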